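{- Let $n\ge 1$, $N=2^n$, and let $\pi$ be any permutation of $\{0,1,\dots,N-1\}$. The number $r$ of multiple-control Toffoli gates returned by the hypercube synthesis procedure (described in the context) on input $\pi$ satisfies $r\le (n-1)2^n+1$.
   Context: For $v\in\{0,\dots,N-1\}$ and $j\in\{0,\dots,n-1\}$, $v\oplus 2^j$ denotes $v$ with bit $j$ of its binary expansion flipped (bit $0$ least significant). A multiple-control Toffoli gate on $n$ lines with target line $j$ and all other $n-1$ lines as (positive or negative) controls acts on $\{0,\dots,N-1\}$ as a transposition $g_{j,v}$ swapping $v$ and $v\oplus 2^j$. A permutation $\pi$ is stored as the table $(\pi[0],\dots,\pi[N-1])$; applying a gate $g$ replaces the table by $g\circ\pi$. Hypercube synthesis procedure: for $i=N-1,N-2,\dots,1$ (in this order), and for each $j=0,1,\dots,n-1$ (least significant bit first), if bit $j$ of the current entry $\pi[i]$ differs from bit $j$ of $i$, let $v$ be the current value of $\pi[i]$, push $g_{j,v}$ onto the output list and replace the table by $g_{j,v}\circ\pi$. Output the list of pushed gates; $r$ is its length. -}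

module Defs where

open import Data.Nat using (ℕ; zero; suc; _+_; _∸_; _^_; _≡ᵇ_)
open import Data.Nat.DivMod using (_/_; _%_)
open import Data.Bool using (Bool; true; false; if_then_else_)
open import Data.List using (List; []; _∷_; _++_; [_])
open import Data.Product using (_×_; _,_; proj₁; proj₂)
open import Data.Fin using (Fin; toℕ; fromℕ<)
open import Data.Nat using (_<?_)
open import Relation.Nullary using (yes; no)
open import Data.Fin.Permutation using (Permutation′; _⟨$⟩ʳ_)

bit : ℕ → ℕ → ℕ
bit x zero = x % 2
bit x (suc j) = bit (x / 2) j

flip : ℕ → ℕ → ℕ
flip x j = if bit x j ≡ᵇ 1 then x ∸ 2 ^ j else x + 2 ^ j

Table : Set
Table = ℕ → ℕ

-- A gate g_{j,v} is recorded as the pair (j , v): it is the transposition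
-- swapping v and v ⊕ 2^j.
Gate : Set
Gate = ℕ × ℕ

applyGate : Gate → ℕ → ℕ
applyGate (j , v) x =
  if x ≡ᵇ v then flip v j else (if x ≡ᵇ flip v j then v else x)

applyGateTable : Gate → Table → Table
applyGateTable g π i = applyGate g (π i)

innerLoop : ℕ → ℕ → ℕ → Table × List Gate → Table × List Gate
innerLoop i j zero st = st
innerLoop i j (suc k) (π , gs) =
  if bit (π i) j ≡ᵇ bit i j
  then innerLoop i (suc j) k (π , gs)
  else innerLoop i (suc j) k (applyGateTable (j , π i) π , gs ++ [ (j , π i) ])

outerLoop : ℕ → ℕ → Table × List Gate → Table × List Gate
outerLoop n zero st = st
outerLoop n (suc m) st = outerLoop n m (innerLoop (suc m) 0 n st)

synthesize : ℕ → Table → List Gate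
synthesize n π = proj₂ (outerLoop n (2 ^ n ∸ 1) (π , []))

-- the table of a permutation of {0,…,N-1}, extended by 0 outside the range
-- (entries outside the range are never read by the procedure)
tableOf : ∀ {N} → Permutation′ N → Table
tableOf {N} σ i with i <? N
... | yes i<N = toℕ (σ ⟨$⟩ʳ fromℕ< i<N)
... | no _ = 0

module Submission where

-- Hypercube synthesis processes rows i = N-1, …, 1 and, in row i, fixes
-- the bits of the entry from the least significant one upwards.
--
-- Invariant ("settled above m"): the table permutes [0, N) and fixes every
-- point above m.  In row i the entry x is then at most i, and after the
-- bits below j have been treated the entry equals splice x i j, the
-- number x with its j lowest bits replaced by those of i.  Such values
-- stay ≤ i, so each gate only swaps values ≤ i and the rows above remain
-- settled, while at j = n the entry has become i.  A gate is emitted only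
-- where x and i differ in bit j, which forces j < L whenever x ≤ i < 2^L.
--
-- Hence each of the 2^l rows in [2^l, 2^(l+1)) costs at most l + 1 gates,
-- and summing, r ≤ Σ_{l<n} (l + 1)·2^l = (n - 1)·2^n + 1.

open import Defs
open import Data.Nat using (ℕ; _≥_; _≤_; _+_; _*_; _∸_; _^_)
open import Data.List using (length)
open import Data.Fin.Permutation using (Permutation′)
open import Data.Nat using (zero; suc; pred; _<_; _≤?_; _<?_; _≟_; _≡ᵇ_; z≤n; s≤s; 2+)
open import Data.Nat.Properties
open import Data.Nat.DivMod
open import Data.Nat.Tactic.RingSolver using (solve-∀)
open import Data.Bool using (true; false; if_then_else_; T)
open import Data.Unit using (tt)
open import Data.Sum using (_⊎_; inj₁; inj₂)
open import Data.List using (List; []; _++_; [_])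
open import Data.List.Properties using (length-++)
open import Data.Product using (_×_; _,_; proj₁; proj₂)
open import Data.Fin using (toℕ; fromℕ<)
open import Data.Fin.Properties using (toℕ-injective; toℕ<n; toℕ-fromℕ<)
open import Data.Fin.Permutation using (_⟨$⟩ʳ_; _⟨$⟩ˡ_; inverseˡ)
open import Relation.Binary.PropositionalEquality hiding ([_])
open import Relation.Nullary using (yes; no)
open import Data.Empty using (⊥-elim)

digit-div : ∀ {r} s → r < 2 → (r + s * 2) / 2 ≡ s
digit-div {0} s _ = m*n/n≡m s 2
digit-div {1} s _ = trans (+-distrib-/ 1 (s * 2) (s≤s (s≤s (≤-reflexive (m*n%n≡0 s 2)))))
                          (m*n/n≡m s 2)
digit-div {2+ _} _ (s≤s (s≤s ()))

bit<2 : ∀ y j → bit y j < 2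
bit<2 y zero = m%n<n y 2
bit<2 y (suc j) = bit<2 (y / 2) j

bit-small : ∀ {y} j → y < 2 ^ j → bit y j ≡ 0
bit-small {zero} zero _ = refl
bit-small {suc _} zero (s≤s ())
bit-small {y} (suc j) y<2^j+1 =
  bit-small j (m<n*o⇒m/o<n (subst (y <_) (*-comm 2 (2 ^ j)) y<2^j+1))

bit-set : ∀ {y} j → bit y j ≡ 1 → 2 ^ j ≤ y
bit-set {y} j b≡1 = ≮⇒≥ (λ y<2^j → 0≢1+n (trans (sym (bit-small j y<2^j)) b≡1))

bit-cases : ∀ y j → bit y j ≡ 0 ⊎ bit y j ≡ 1
bit-cases y j with bit y j | bit<2 y j
... | 0 | _ = inj₁ refl
... | 1 | _ = inj₂ refl
... | 2+ _ | s≤s (s≤s ())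

bit-digits : ∀ {r} s j → r < 2 → bit (r + s * 2) (suc j) ≡ bit s j
bit-digits s j r<2 = cong (λ t → bit t j) (digit-div s r<2)

flip-clear : ∀ y j → bit y j ≡ 0 → flip y j ≡ y + 2 ^ j
flip-clear y j b≡0 = cong (λ b → if b ≡ᵇ 1 then y ∸ 2 ^ j else y + 2 ^ j) b≡0

flip-set : ∀ y j → bit y j ≡ 1 → flip y j ≡ y ∸ 2 ^ j
flip-set y j b≡1 = cong (λ b → if b ≡ᵇ 1 then y ∸ 2 ^ j else y + 2 ^ j) b≡1

flip-digit : ∀ {r} s j → r < 2 → flip (r + s * 2) (suc j) ≡ r + flip s j * 2
flip-digit {r} s j r<2 with bit-cases s j
... | inj₁ b≡0 = begin
    flip (r + s * 2) (suc j)   ≡⟨ flip-clear (r + s * 2) (suc j) (trans (bit-digits s j r<2) b≡0) ⟩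
    r + s * 2 + 2 * 2 ^ j      ≡⟨ regroup r s (2 ^ j) ⟩
    r + (s + 2 ^ j) * 2        ≡⟨ cong (λ t → r + t * 2) (flip-clear s j b≡0) ⟨
    r + flip s j * 2           ∎
  where
  open ≡-Reasoning
  regroup : ∀ r s p → r + s * 2 + 2 * p ≡ r + (s + p) * 2
  regroup = solve-∀
... | inj₂ b≡1 = begin
    flip (r + s * 2) (suc j)          ≡⟨ flip-set (r + s * 2) (suc j) (trans (bit-digits s j r<2) b≡1) ⟩
    r + s * 2 ∸ 2 * 2 ^ j             ≡⟨ cong (λ t → r + t * 2 ∸ 2 * 2 ^ j) (m∸n+n≡m (bit-set j b≡1)) ⟨
    r + (d + 2 ^ j) * 2 ∸ 2 * 2 ^ j   ≡⟨ cong (_∸ 2 * 2 ^ j) (regroup r d (2 ^ j)) ⟩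
    r + d * 2 + 2 * 2 ^ j ∸ 2 * 2 ^ j ≡⟨ m+n∸n≡m (r + d * 2) (2 * 2 ^ j) ⟩
    r + d * 2                         ≡⟨ cong (λ t → r + t * 2) (flip-set s j b≡1) ⟨
    r + flip s j * 2                  ∎
  where
  open ≡-Reasoning
  d : ℕ
  d = s ∸ 2 ^ j
  regroup : ∀ r d p → r + (d + p) * 2 ≡ r + d * 2 + 2 * p
  regroup = solve-∀

last-digit : ∀ x {r} → x % 2 ≡ r → x ≡ r + x / 2 * 2
last-digit x x%2≡r = trans (m≡m%n+[m/n]*n x 2) (cong (_+ x / 2 * 2) x%2≡r)

flip-last : ∀ x {c} → bit x 0 ≢ c → c < 2 → flip x 0 ≡ c + x / 2 * 2
flip-last x {0} ne _ with bit-cases x 0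
... | inj₁ b≡0 = ⊥-elim (ne b≡0)
... | inj₂ b≡1 = trans (flip-set x 0 b≡1) (cong (_∸ 1) (last-digit x b≡1))
flip-last x {1} ne _ with bit-cases x 0
... | inj₁ b≡0 = trans (flip-clear x 0 b≡0) (trans (+-comm x 1) (cong suc (last-digit x b≡0)))
... | inj₂ b≡1 = ⊥-elim (ne b≡1)
flip-last _ {2+ _} _ (s≤s (s≤s ()))

splice : ℕ → ℕ → ℕ → ℕ
splice x i zero = x
splice x i (suc j) = i % 2 + splice (x / 2) (i / 2) j * 2

bit-splice : ∀ x i j → bit (splice x i j) j ≡ bit x j
bit-splice x i zero = refl
bit-splice x i (suc j) =
  trans (bit-digits (splice (x / 2) (i / 2) j) j (m%n<n i 2)) (bit-splice (x / 2) (i / 2) j)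

splice-agree : ∀ x i j → bit x j ≡ bit i j → splice x i (suc j) ≡ splice x i j
splice-agree x i zero x%2≡i%2 = sym (last-digit x x%2≡i%2)
splice-agree x i (suc j) b≡b =
  cong (λ t → i % 2 + t * 2) (splice-agree (x / 2) (i / 2) j b≡b)

splice-flip : ∀ x i j → bit x j ≢ bit i j → flip (splice x i j) j ≡ splice x i (suc j)
splice-flip x i zero ne = flip-last x ne (m%n<n i 2)
splice-flip x i (suc j) ne = begin
    flip (i % 2 + s * 2) (suc j)  ≡⟨ flip-digit s j (m%n<n i 2) ⟩
    i % 2 + flip s j * 2          ≡⟨ cong (λ t → i % 2 + t * 2) (splice-flip (x / 2) (i / 2) j ne) ⟩
    splice x i (suc (suc j))      ∎
  where
  open ≡-Reasoning
  s : ℕ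
  s = splice (x / 2) (i / 2) j

splice-≤ : ∀ {x i} j → x ≤ i → splice x i j ≤ i
splice-≤ zero x≤i = x≤i
splice-≤ {x} {i} (suc j) x≤i = begin
    i % 2 + splice (x / 2) (i / 2) j * 2 ≤⟨ +-monoʳ-≤ (i % 2) (*-monoˡ-≤ 2 (splice-≤ j (/-monoˡ-≤ 2 x≤i))) ⟩
    i % 2 + i / 2 * 2                    ≡⟨ m≡m%n+[m/n]*n i 2 ⟨
    i                                    ∎
  where open ≤-Reasoning

splice-all : ∀ {x i} j → x < 2 ^ j → i < 2 ^ j → splice x i j ≡ i
splice-all {zero} {zero} zero _ _ = refl
splice-all {zero} {suc _} zero _ (s≤s ())
splice-all {suc _} zero (s≤s ()) _
splice-all {x} {i} (suc j) x< i< =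
  trans (cong (λ t → i % 2 + t * 2) (splice-all j (halve x<) (halve i<))) (sym (m≡m%n+[m/n]*n i 2))
  where
  halve : ∀ {y} → y < 2 ^ suc j → y / 2 < 2 ^ j
  halve {y} y< = m<n*o⇒m/o<n (subst (y <_) (*-comm 2 (2 ^ j)) y<)

differ⇒< : ∀ {x i L} j → x < 2 ^ L → i < 2 ^ L → bit x j ≢ bit i j → j < L
differ⇒< {L = L} j x< i< differ with L ≤? j
... | no L≰j = ≰⇒> L≰j
... | yes L≤j = ⊥-elim (differ (trans (bit-small j (raise x<)) (sym (bit-small j (raise i<)))))
  where
  raise : ∀ {y} → y < 2 ^ L → y < 2 ^ j
  raise y< = <-≤-trans y< (^-monoʳ-≤ 2 L≤j)

≡ᵇ-refl : ∀ x → (x ≡ᵇ x) ≡ true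
≡ᵇ-refl zero = refl
≡ᵇ-refl (suc x) = ≡ᵇ-refl x

≡ᵇ-true⇒≡ : ∀ {x y} → (x ≡ᵇ y) ≡ true → x ≡ y
≡ᵇ-true⇒≡ {x} {y} x≡ᵇy = ≡ᵇ⇒≡ x y (subst T (sym x≡ᵇy) tt)

≡ᵇ-false⇒≢ : ∀ {x y} → (x ≡ᵇ y) ≡ false → x ≢ y
≡ᵇ-false⇒≢ {x} x≡ᵇy refl with trans (sym (≡ᵇ-refl x)) x≡ᵇy
... | ()

≢⇒≡ᵇ-false : ∀ {x y} → x ≢ y → (x ≡ᵇ y) ≡ false
≢⇒≡ᵇ-false {x} {y} x≢y with x ≡ᵇ y in x≡ᵇy
... | true = ⊥-elim (x≢y (≡ᵇ-true⇒≡ x≡ᵇy))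
... | false = refl

swap : ℕ → ℕ → ℕ → ℕ
swap a b x = if x ≡ᵇ a then b else (if x ≡ᵇ b then a else x)

swap-left : ∀ a b → swap a b a ≡ b
swap-left a b rewrite ≡ᵇ-refl a = refl

swap-right : ∀ a b → swap a b b ≡ a
swap-right a b with b ≟ a
... | yes refl rewrite ≡ᵇ-refl b = refl
... | no b≢a rewrite ≢⇒≡ᵇ-false b≢a | ≡ᵇ-refl b = refl

swap-fixes : ∀ {a b x} → x ≢ a → x ≢ b → swap a b x ≡ x
swap-fixes x≢a x≢b rewrite ≢⇒≡ᵇ-false x≢a | ≢⇒≡ᵇ-false x≢b = refl

swap-preserves : (P : ℕ → Set) → ∀ {a b x} → P a → P b → P x → P (swap a b x)
swap-preserves P {a} {b} {x} pa pb px with x ≡ᵇ a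
... | true = pb
... | false with x ≡ᵇ b
... | true = pa
... | false = px

swap-involutive : ∀ a b x → swap a b (swap a b x) ≡ x
swap-involutive a b x with x ≟ a | x ≟ b
... | yes refl | _ = trans (cong (swap x b) (swap-left x b)) (swap-right x b)
... | no x≢a | yes refl = trans (cong (swap a x) (swap-right a x)) (swap-left a x)
... | no x≢a | no x≢b = trans (cong (swap a b) (swap-fixes x≢a x≢b)) (swap-fixes x≢a x≢b)

swap-injective : ∀ a b {x y} → swap a b x ≡ swap a b y → x ≡ y
swap-injective a b {x} {y} eq =
  trans (sym (swap-involutive a b x)) (trans (cong (swap a b) eq) (swap-involutive a b y))

pred<⇒≤ : ∀ i {y} → pred i < y → i ≤ y
pred<⇒≤ zero _ = z≤n
pred<⇒≤ (suc _) i≤y = i≤y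

module Tables (N : ℕ) where

  -- T permutes [0, N) and fixes every point above m: the state of the
  -- synthesis once rows N-1, …, m+1 have been processed.
  record Settled (m : ℕ) (T : Table) : Set where
    field
      bounded   : ∀ {y} → y < N → T y < N
      injective : ∀ {y z} → y < N → z < N → T y ≡ T z → y ≡ z
      fixed     : ∀ {y} → m < y → y < N → T y ≡ y
  open Settled

  -- The entry of the row being processed never exceeds the row index,
  -- since all larger values are already taken by the settled rows.
  entry-≤ : ∀ {i T} → Settled i T → i < N → T i ≤ i
  entry-≤ {i} {T} S i<N with T i ≤? i
  ... | yes Ti≤i = Ti≤i
  ... | no Ti≰i = ⊥-elim (<⇒≢ i<Ti (sym (injective S Ti<N i<N (fixed S i<Ti Ti<N))))
    where
    i<Ti : i < T i
    i<Ti = ≰⇒> Ti≰i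
    Ti<N : T i < N
    Ti<N = bounded S i<N

  swap-settled : ∀ {i T w} → Settled i T → i < N → w ≤ i →
                 Settled i (λ y → swap (T i) w (T y))
  swap-settled {i} {T} {w} S i<N w≤i = record
    { bounded   = λ y<N → swap-preserves (_< N) (bounded S i<N) (≤-<-trans w≤i i<N) (bounded S y<N)
    ; injective = λ y<N z<N eq → injective S y<N z<N (swap-injective (T i) w eq)
    ; fixed     = fixed′
    }
    where
    fixed′ : ∀ {y} → i < y → y < N → swap (T i) w (T y) ≡ y
    fixed′ {y} i<y y<N = trans (cong (swap (T i) w) Ty≡y) (swap-fixes y≢Ti y≢w)
      where
      Ty≡y : T y ≡ y
      Ty≡y = fixed S i<y y<N
      y≢Ti : y ≢ T i
      y≢Ti y≡Ti = <⇒≢ i<y (sym (injective S y<N i<N (trans Ty≡y y≡Ti)))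
      y≢w : y ≢ w
      y≢w y≡w = <⇒≢ (≤-<-trans w≤i i<y) (sym y≡w)

  settle-row : ∀ {i T} → Settled i T → T i ≡ i → Settled (pred i) T
  settle-row {i} {T} S Ti≡i = record
    { bounded = bounded S ; injective = injective S ; fixed = fixed′ }
    where
    fixed′ : ∀ {y} → pred i < y → y < N → T y ≡ y
    fixed′ {y} p y<N with i ≟ y
    ... | yes refl = Ti≡i
    ... | no i≢y = fixed S (≤∧≢⇒< (pred<⇒≤ i p) i≢y) y<N

  tableOf-settled : (σ : Permutation′ N) → Settled (pred N) (tableOf σ)
  tableOf-settled σ = record
    { bounded   = λ {y} y<N → subst (_< N) (sym (tableOf-≡ y<N)) (toℕ<n _)
    ; injective = injective′
    ; fixed     = λ N-1<y y<N → ⊥-elim (<⇒≱ y<N (pred<⇒≤ N N-1<y))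
    }
    where
    tableOf-≡ : ∀ {y} (y<N : y < N) → tableOf σ y ≡ toℕ (σ ⟨$⟩ʳ fromℕ< y<N)
    tableOf-≡ {y} y<N with y <? N
    ... | yes _ = refl
    ... | no y≮N = ⊥-elim (y≮N y<N)
    injective′ : ∀ {y z} → y < N → z < N → tableOf σ y ≡ tableOf σ z → y ≡ z
    injective′ y<N z<N eq = begin
        _                                 ≡⟨ toℕ-fromℕ< y<N ⟨
        toℕ (fromℕ< y<N)                  ≡⟨ cong toℕ (inverseˡ σ) ⟨
        toℕ (σ ⟨$⟩ˡ (σ ⟨$⟩ʳ fromℕ< y<N))  ≡⟨ cong (λ k → toℕ (σ ⟨$⟩ˡ k)) same-image ⟩
        toℕ (σ ⟨$⟩ˡ (σ ⟨$⟩ʳ fromℕ< z<N))  ≡⟨ cong toℕ (inverseˡ σ) ⟩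
        toℕ (fromℕ< z<N)                  ≡⟨ toℕ-fromℕ< z<N ⟩
        _                                 ∎
      where
      open ≡-Reasoning
      same-image : σ ⟨$⟩ʳ fromℕ< y<N ≡ σ ⟨$⟩ʳ fromℕ< z<N
      same-image = toℕ-injective (trans (sym (tableOf-≡ y<N)) (trans eq (tableOf-≡ z<N)))

length-snoc : ∀ {A : Set} (gs : List A) g {j L} → j < L →
              length (gs ++ [ g ]) + (L ∸ suc j) ≡ length gs + (L ∸ j)
length-snoc gs g {j} {L} j<L = begin
    length (gs ++ [ g ]) + (L ∸ suc j) ≡⟨ cong (_+ (L ∸ suc j)) (length-++ gs) ⟩
    length gs + 1 + (L ∸ suc j)        ≡⟨ +-assoc (length gs) 1 (L ∸ suc j) ⟩
    length gs + (1 + (L ∸ suc j))      ≡⟨ cong (length gs +_) (+-∸-assoc 1 j<L) ⟨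
    length gs + (L ∸ j)                ∎
  where open ≡-Reasoning

2^suc : ∀ k → 2 ^ suc k ≡ 2 ^ k + 2 ^ k
2^suc k = cong (2 ^ k +_) (+-identityʳ (2 ^ k))

-- rowsCost k = Σ_{l<k} (l + 1)·2^l bounds the gates spent on the rows
-- 1, …, 2^k - 1: each of the 2^l rows in [2^l, 2^(l+1)) costs ≤ l + 1.
rowsCost : ℕ → ℕ
rowsCost zero = 0
rowsCost (suc k) = rowsCost k + 2 ^ k * suc k

rowsCost-closed : ∀ k → rowsCost (suc k) ≡ k * 2 ^ suc k + 1
rowsCost-closed zero = refl
rowsCost-closed (suc k) = begin
    rowsCost (suc k) + 2 ^ suc k * suc (suc k) ≡⟨ cong (_+ 2 ^ suc k * suc (suc k)) (rowsCost-closed k) ⟩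
    k * 2 ^ suc k + 1 + 2 ^ suc k * suc (suc k) ≡⟨ regroup k (2 ^ suc k) ⟩
    suc k * (2 ^ suc k + 2 ^ suc k) + 1         ≡⟨ cong (λ p → suc k * p + 1) (2^suc (suc k)) ⟨
    suc k * 2 ^ suc (suc k) + 1                 ∎
  where
  open ≡-Reasoning
  regroup : ∀ k p → k * p + 1 + p * suc (suc k) ≡ suc k * (p + p) + 1
  regroup = solve-∀

module Synthesis (n : ℕ) where
  open Tables (2 ^ n)

  Progress : ℕ → ℕ → List Gate → Table × List Gate → Set
  Progress m c gs st = length (proj₂ st) ≤ length gs + c × Settled m (proj₁ st)

  entry-bit : ∀ {y} x i j → y ≡ splice x i j → bit y j ≡ bit x j
  entry-bit x i j y≡ = trans (cong (λ t → bit t j) y≡) (bit-splice x i j)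

  row : ∀ {i x L} → i < 2 ^ n → i < 2 ^ L → x ≤ i →
        ∀ j k → j + k ≡ n → ∀ T gs → Settled i T → T i ≡ splice x i j →
        Progress (pred i) (L ∸ j) gs (innerLoop i j k (T , gs))
  row {i} {x} i<N i<2^L x≤i j zero j+0≡n T gs S Ti≡ =
    m≤m+n _ _ , settle-row S (trans Ti≡ (splice-all j (below x<N) (below i<N)))
    where
    x<N : x < 2 ^ n
    x<N = ≤-<-trans x≤i i<N
    below : ∀ {y} → y < 2 ^ n → y < 2 ^ j
    below = subst (λ m → _ < 2 ^ m) (trans (sym j+0≡n) (+-identityʳ j))
  row {i} {x} {L} i<N i<2^L x≤i j (suc k) j+k+1≡n T gs S Ti≡
    with bit (T i) j ≡ᵇ bit i j in agree?
  ... | true = ≤-trans (proj₁ rest) (+-monoʳ-≤ (length gs) (∸-monoʳ-≤ L (n≤1+n j))) , proj₂ rest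
    where
    agree : bit x j ≡ bit i j
    agree = trans (sym (entry-bit x i j Ti≡)) (≡ᵇ-true⇒≡ agree?)
    rest : Progress (pred i) (L ∸ suc j) gs (innerLoop i (suc j) k (T , gs))
    rest = row {L = L} i<N i<2^L x≤i (suc j) k (trans (sym (+-suc j k)) j+k+1≡n) T gs S
                         (trans Ti≡ (sym (splice-agree x i j agree)))
  ... | false = ≤-trans (proj₁ rest) (≤-reflexive (length-snoc gs (j , T i) j<L)) , proj₂ rest
    where
    differ : bit x j ≢ bit i j
    differ b≡b = ≡ᵇ-false⇒≢ agree? (trans (entry-bit x i j Ti≡) b≡b)
    j<L : j < L
    j<L = differ⇒< j (≤-<-trans x≤i i<2^L) i<2^L differ
    flipped : flip (T i) j ≡ splice x i (suc j)
    flipped = trans (cong (λ t → flip t j) Ti≡) (splice-flip x i j differ)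
    S′ : Settled i (applyGateTable (j , T i) T)
    S′ = swap-settled S i<N (subst (_≤ i) (sym flipped) (splice-≤ (suc j) x≤i))
    rest : Progress (pred i) (L ∸ suc j) (gs ++ [ (j , T i) ])
             (innerLoop i (suc j) k (applyGateTable (j , T i) T , gs ++ [ (j , T i) ]))
    rest = row {L = L} i<N i<2^L x≤i (suc j) k (trans (sym (+-suc j k)) j+k+1≡n)
                         (applyGateTable (j , T i) T) (gs ++ [ (j , T i) ]) S′
                         (trans (swap-left (T i) (flip (T i) j)) flipped)

  -- Rows m, m-1, …, 1, where m + 1 = 2^k + c with c ≤ 2^k: the c rows in
  -- [2^k, m] cost at most k + 1 gates each, the rows below 2^k at most
  -- rowsCost k.
  rows : ∀ k c m → suc m ≡ 2 ^ k + c → c ≤ 2 ^ k → m < 2 ^ n →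
         ∀ T gs → Settled m T →
         length (proj₂ (outerLoop n m (T , gs))) ≤ length gs + (c * suc k + rowsCost k)
  rows zero zero zero _ _ _ T gs _ = m≤m+n (length gs) 0
  rows (suc k) zero m m+1≡ _ m<N T gs S = begin
      length (proj₂ (outerLoop n m (T , gs)))  ≤⟨ rows k (2 ^ k) m m+1≡2^k+2^k ≤-refl m<N T gs S ⟩
      length gs + (2 ^ k * suc k + rowsCost k) ≡⟨ cong (length gs +_) (+-comm (2 ^ k * suc k) (rowsCost k)) ⟩
      length gs + rowsCost (suc k)             ∎
    where
    open ≤-Reasoning
    m+1≡2^k+2^k : suc m ≡ 2 ^ k + 2 ^ k
    m+1≡2^k+2^k = trans m+1≡ (trans (+-identityʳ _) (2^suc k))
  rows k (suc c) zero 1≡ _ _ T gs _ =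
    ⊥-elim (<⇒≢ (≤-trans (m^n>0 2 k) (m≤m+n (2 ^ k) c)) (suc-injective (trans 1≡ (+-suc (2 ^ k) c))))
  rows k (suc c) (suc m) m+2≡ c<2^k m+1<N T gs S = begin
      length (proj₂ (outerLoop n m (innerLoop (suc m) 0 n (T , gs))))
        ≤⟨ rows k c m m+1≡ (<⇒≤ c<2^k) (<-trans (n<1+n m) m+1<N) _ _ (proj₂ row-m+1) ⟩
      length (proj₂ (innerLoop (suc m) 0 n (T , gs))) + (c * suc k + rowsCost k)
        ≤⟨ +-monoˡ-≤ _ (proj₁ row-m+1) ⟩
      length gs + suc k + (c * suc k + rowsCost k)
        ≡⟨ regroup (length gs) (suc k) (c * suc k) (rowsCost k) ⟩
      length gs + (suc c * suc k + rowsCost k) ∎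
    where
    open ≤-Reasoning
    m+1≡ : suc m ≡ 2 ^ k + c
    m+1≡ = suc-injective (trans m+2≡ (+-suc (2 ^ k) c))
    m+1<2^k+1 : suc m < 2 ^ suc k
    m+1<2^k+1 = ≤-trans (≤-reflexive m+2≡) (subst (2 ^ k + suc c ≤_) (sym (2^suc k)) (+-monoʳ-≤ (2 ^ k) c<2^k))
    row-m+1 : Progress m (suc k) gs (innerLoop (suc m) 0 n (T , gs))
    row-m+1 = row {L = suc k} m+1<N m+1<2^k+1 (entry-≤ S m+1<N) 0 n refl T gs S refl
    regroup : ∀ a b d e → a + b + (d + e) ≡ a + (b + d + e)
    regroup = solve-∀

mainTheorem2 : (n : ℕ) → n ≥ 1 → (π : Permutation′ (2 ^ n)) →
    length (synthesize n (tableOf π)) ≤ (n ∸ 1) * 2 ^ n + 1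
mainTheorem2 n@(suc n-1) _ π = begin
    length (synthesize n (tableOf π)) ≤⟨ rows n 0 (pred N) N≡ z≤n pred[N]<N (tableOf π) [] (tableOf-settled π) ⟩
    rowsCost n                        ≡⟨ rowsCost-closed n-1 ⟩
    n-1 * 2 ^ n + 1                   ∎
  where
  open ≤-Reasoning
  open Tables (2 ^ n)
  open Synthesis n
  N : ℕ
  N = 2 ^ n
  N≡ : suc (pred N) ≡ N + 0
  N≡ = trans (suc-pred N {{m^n≢0 2 n}}) (sym (+-identityʳ N))
  pred[N]<N : pred N < N
  pred[N]<N = ≤-reflexive (suc-pred N {{m^n≢0 2 n}})
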